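{- Let $\mathbb{K}$ be a totally ordered field and ${}^*\mathbb{K}$ a non-standard extension of $\mathbb{K}$. If every $\alpha\in\mathcal{F}({}^*\mathbb{K})$ can be written uniquely as $\alpha=k+d\alpha$ with $k\in\mathbb{K}$ and $d\alpha\in\mathcal{I}({}^*\mathbb{K})$, then $\mathbb{K}$ is Archimedean.
   Context: ${}^*\mathbb{K}$ is a non-standard extension of $\mathbb{K}$ in the sense of Robinson's non-standard analysis; it is a totally ordered field containing $\mathbb{K}$ whose order extends that of $\mathbb{K}$. $\mathcal{F}({}^*\mathbb{K})=\{x\in{}^*\mathbb{K}:\exists n\in\mathbb{N},\ |x|\le n\}$ and $\mathcal{I}({}^*\mathbb{K})=\{x\in{}^*\mathbb{K}:\forall n\in\mathbb{N},\ |x|<1/n\}$. $\mathbb{K}$ is Archimedean if for every $x\in\mathbb{K}$ there is $n\in\mathbb{N}$ with $|x|<n$. -}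

module Defs where

open import Level using (Level; _⊔_) renaming (suc to lsuc)
open import Data.Nat using (ℕ; zero; suc)
open import Data.Product using (_×_; ∃; ∃-syntax; _,_)
open import Relation.Nullary using (¬_)
open import Relation.Binary.Core using (Rel)
open import Relation.Binary.Structures using (IsTotalOrder)
open import Algebra.Core using (Op₁; Op₂)
open import Algebra.Structures using (IsCommutativeRing)

record OrderedField (c ℓ : Level) : Set (lsuc (c ⊔ ℓ)) where
  infixl 7 _*_
  infixl 6 _+_
  infix 4 _≈_ _≤_ _<_
  field
    Carrier : Set c
    _≈_ : Rel Carrier ℓ
    _+_ : Op₂ Carrier
    _*_ : Op₂ Carrier
    -_ : Op₁ Carrier
    0# : Carrier
    1# : Carrier
    isCommutativeRing : IsCommutativeRing _≈_ _+_ _*_ -_ 0# 1#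
    0≉1 : ¬ (0# ≈ 1#)
    inverse : ∀ x → ¬ (x ≈ 0#) → ∃[ y ] (x * y ≈ 1#)
    _≤_ : Rel Carrier ℓ
    isTotalOrder : IsTotalOrder _≈_ _≤_
    +-mono-≤ : ∀ {x y} z → x ≤ y → x + z ≤ y + z
    *-nonneg : ∀ {x y} → 0# ≤ x → 0# ≤ y → 0# ≤ x * y

  _<_ : Rel Carrier ℓ
  x < y = (x ≤ y) × ¬ (x ≈ y)

  abs≤ : Carrier → Carrier → Set ℓ
  abs≤ x y = (x ≤ y) × (- x ≤ y)

  abs< : Carrier → Carrier → Set ℓ
  abs< x y = (x < y) × (- x < y)

  fromℕ : ℕ → Carrier
  fromℕ zero = 0#
  fromℕ (suc n) = 1# + fromℕ n

  Finite : Carrier → Set ℓ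
  Finite x = ∃[ n ] abs≤ x (fromℕ n)

  -- infinitesimal: ∀ n ≥ 1, |x| < 1/n  (y is the inverse of n)
  Infinitesimal : Carrier → Set (c ⊔ ℓ)
  Infinitesimal x = ∀ n (y : Carrier) → fromℕ (suc n) * y ≈ 1# → abs< x y

  Archimedean : Set (c ⊔ ℓ)
  Archimedean = ∀ x → ∃[ n ] abs< x (fromℕ n)

-- An ordered field L containing K, with order extending that of K:
-- an embedding ι : K → L of ordered fields.
record OrderedFieldExtension {c ℓ c′ ℓ′ : Level}
         (K : OrderedField c ℓ) (L : OrderedField c′ ℓ′) : Set (c ⊔ ℓ ⊔ c′ ⊔ ℓ′) where
  private
    module K = OrderedField K
    module L = OrderedField L
  field
    ι : K.Carrier → L.Carrier
    ι-cong : ∀ {x y} → x K.≈ y → ι x L.≈ ι y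
    ι-+ : ∀ x y → ι (x K.+ y) L.≈ ι x L.+ ι y
    ι-* : ∀ x y → ι (x K.* y) L.≈ ι x L.* ι y
    ι-0 : ι K.0# L.≈ L.0#
    ι-1 : ι K.1# L.≈ L.1#
    ι-mono : ∀ {x y} → x K.≤ y → ι x L.≤ ι y
    ι-reflect : ∀ {x y} → ι x L.≤ ι y → x K.≤ y

module Submission where

-- Suppose the standard-part decomposition α = k + dα of
-- finite elements α of *K is unique, and suppose some x ∈ K is not bounded
-- by any natural number.  Classically |x| ≥ n for every n ∈ ℕ, so K contains
-- an infinitely large element t; its reciprocal s = 1/t is a nonzero
-- infinitesimal of K, and its image ι s is an infinitesimal of *K.  But then
-- ι s = ι s + 0 = ι 0 + ι s are two decompositions of the finite element
-- ι s, and uniqueness forces s ≈ 0, contradicting t · s ≈ 1.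

open import Defs
open import Level using (Level; _⊔_; lift; lower)
open import Data.Nat using (zero; suc)
open import Data.Product using (_×_; ∃; ∃-syntax; _,_; proj₁; proj₂)
open import Data.Sum using (_⊎_; inj₁; inj₂; [_,_])
open import Data.Empty using (⊥-elim)
open import Relation.Nullary using (¬_; yes; no)
open import Relation.Nullary.Decidable using (map′)
open import Axiom.ExcludedMiddle using (ExcludedMiddle)
open import Algebra.Bundles using (CommutativeRing)
open import Relation.Binary.Bundles using (TotalOrder)
import Algebra.Properties.Ring as RingProperties
import Relation.Binary.Properties.TotalOrder as TotalOrderProperties
import Relation.Binary.Reasoning.PartialOrder as PartialOrderReasoning
import Relation.Binary.Reasoning.Setoid as SetoidReasoning

lowerExcludedMiddle : ∀ {a} b → ExcludedMiddle (a ⊔ b) → ExcludedMiddle a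
lowerExcludedMiddle b em = map′ (lower {ℓ = b}) lift em

module OrderedFieldProperties {c ℓ : Level} (F : OrderedField c ℓ) where
  open OrderedField F public

  commutativeRing : CommutativeRing c ℓ
  commutativeRing = record { isCommutativeRing = isCommutativeRing }

  totalOrder : TotalOrder c ℓ ℓ
  totalOrder = record { isTotalOrder = isTotalOrder }

  open CommutativeRing commutativeRing public
    using ( ring; setoid; +-assoc; +-comm; +-identityˡ; +-identityʳ
          ; -‿inverseˡ; -‿inverseʳ; zeroʳ; distribˡ; *-comm; *-identityʳ
          ; +-cong; +-congˡ; +-congʳ; *-congˡ; -‿cong )
    renaming (refl to ≈-refl; sym to ≈-sym; trans to ≈-trans)
  open RingProperties ring public
    using (-0#≈0#; -‿involutive; -‿distribˡ-*; -‿distribʳ-*)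
  open TotalOrder totalOrder public
    using (poset; total; antisym; ≤-respˡ-≈; ≤-respʳ-≈)
    renaming (refl to ≤-refl; reflexive to ≤-reflexive; trans to ≤-trans)
  open TotalOrderProperties totalOrder public using (≰⇒>; <⇒≱)

  module ≤-Reasoning = PartialOrderReasoning poset
  module ≈-Reasoning = SetoidReasoning setoid

  ≤-resp₂-≈ : ∀ {a b c d} → a ≈ b → b ≤ c → c ≈ d → a ≤ d
  ≤-resp₂-≈ a≈b b≤c c≈d = ≤-respʳ-≈ c≈d (≤-respˡ-≈ (≈-sym a≈b) b≤c)

  +-monoʳ-≤ : ∀ {x y} z → x ≤ y → z + x ≤ z + y
  +-monoʳ-≤ z x≤y = ≤-resp₂-≈ (+-comm _ _) (+-mono-≤ z x≤y) (+-comm _ _)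

  +-‿-cancel : ∀ x z → (x + z) + - z ≈ x
  +-‿-cancel x z = ≈-trans (+-assoc x z (- z))
                     (≈-trans (+-congˡ (-‿inverseʳ z)) (+-identityʳ x))

  +-cancelʳ-≤ : ∀ {x y} z → x + z ≤ y + z → x ≤ y
  +-cancelʳ-≤ {x} {y} z p =
    ≤-resp₂-≈ (≈-sym (+-‿-cancel x z)) (+-mono-≤ (- z) p) (+-‿-cancel y z)

  x≤y⇒0≤y-x : ∀ {x y} → x ≤ y → 0# ≤ y + - x
  x≤y⇒0≤y-x {x} p = ≤-resp₂-≈ (≈-sym (-‿inverseʳ x)) (+-mono-≤ (- x) p) ≈-refl

  -- Multiplication by a nonnegative element is monotone: z y - z x = z (y - x) ≥ 0.
  *-monoˡ-≤-nonneg : ∀ {z x y} → 0# ≤ z → x ≤ y → z * x ≤ z * y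
  *-monoˡ-≤-nonneg {z} {x} {y} 0≤z x≤y =
    ≤-resp₂-≈ (≈-sym (+-identityˡ (z * x))) (+-mono-≤ (z * x) 0≤zy-zx) zy-zx+zx≈zy
    where
    zy-zx≈z[y-x] : z * (y + - x) ≈ z * y + - (z * x)
    zy-zx≈z[y-x] = ≈-trans (distribˡ z y (- x)) (+-congˡ (≈-sym (-‿distribʳ-* z x)))

    0≤zy-zx : 0# ≤ z * y + - (z * x)
    0≤zy-zx = ≤-respʳ-≈ zy-zx≈z[y-x] (*-nonneg 0≤z (x≤y⇒0≤y-x x≤y))

    zy-zx+zx≈zy : (z * y + - (z * x)) + z * x ≈ z * y
    zy-zx+zx≈zy = ≈-trans (+-assoc _ _ _)
                    (≈-trans (+-congˡ (-‿inverseˡ (z * x))) (+-identityʳ (z * y)))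

  -- Negation reverses the order: add  - x - y  to both sides of x ≤ y.
  -‿antimono-≤ : ∀ {x y} → x ≤ y → - y ≤ - x
  -‿antimono-≤ {x} {y} x≤y =
    ≤-resp₂-≈ (≈-sym (cancel x (- y))) (+-mono-≤ (- x + - y) x≤y)
              (≈-trans (+-congˡ (+-comm (- x) (- y))) (cancel y (- x)))
    where
    cancel : ∀ a b → a + (- a + b) ≈ b
    cancel a b = ≈-trans (≈-sym (+-assoc a (- a) b))
                   (≈-trans (+-congʳ (-‿inverseʳ a)) (+-identityˡ b))

  -- Squares are nonnegative: split on the sign of x, using (-x)(-x) ≈ x x.
  square-nonneg : ∀ x → 0# ≤ x * x
  square-nonneg x with total 0# x
  ... | inj₁ 0≤x = *-nonneg 0≤x 0≤x
  ... | inj₂ x≤0 = ≤-respʳ-≈ [-x][-x]≈xx (*-nonneg 0≤-x 0≤-x)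
    where
    0≤-x : 0# ≤ - x
    0≤-x = ≤-respˡ-≈ -0#≈0# (-‿antimono-≤ x≤0)

    [-x][-x]≈xx : (- x) * (- x) ≈ x * x
    [-x][-x]≈xx = begin
      (- x) * (- x)   ≈⟨ -‿distribˡ-* x (- x) ⟨
      - (x * - x)     ≈⟨ -‿cong (-‿distribʳ-* x x) ⟨
      - (- (x * x))   ≈⟨ -‿involutive (x * x) ⟩
      x * x           ∎
      where open ≈-Reasoning

  0≤1 : 0# ≤ 1#
  0≤1 = ≤-respʳ-≈ (*-identityʳ 1#) (square-nonneg 1#)

  1≰0 : ¬ (1# ≤ 0#)
  1≰0 1≤0 = 0≉1 (antisym 0≤1 1≤0)

  fromℕ-nonneg : ∀ n → 0# ≤ fromℕ n
  fromℕ-nonneg zero = ≤-refl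
  fromℕ-nonneg (suc n) =
    ≤-trans (≤-reflexive (≈-sym (+-identityˡ 0#)))
            (≤-trans (+-mono-≤ 0# 0≤1) (+-monoʳ-≤ 1# (fromℕ-nonneg n)))

  inverse-positive : ∀ {a y} → 0# ≤ a → a * y ≈ 1# → 0# < y
  inverse-positive {a} {y} 0≤a ay≈1 = ≰⇒> y≰0
    where
    y≰0 : ¬ (y ≤ 0#)
    y≰0 y≤0 = 1≰0 (≤-resp₂-≈ (≈-sym ay≈1) (*-monoˡ-≤-nonneg 0≤a y≤0) (zeroʳ a))

  InfinitelyLarge : Carrier → Set ℓ
  InfinitelyLarge t = ∀ n → fromℕ n ≤ t

  infinitelyLarge≉0 : ∀ {t} → InfinitelyLarge t → ¬ (t ≈ 0#)
  infinitelyLarge≉0 large t≈0 =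
    1≰0 (≤-resp₂-≈ (≈-sym (+-identityʳ 1#)) (large 1) t≈0)

  -- If y = 1/(n+1)
  -- satisfied y ≤ s, then  s + (n+1) s ≤ t s = 1 = (n+1) y ≤ (n+1) s,  so s ≤ 0,
  -- contradicting s > 0; and -s ≤ 0 < y holds as s > 0.
  reciprocal-infinitesimal : ∀ {t s} → InfinitelyLarge t → t * s ≈ 1# → Infinitesimal s
  reciprocal-infinitesimal {t} {s} large ts≈1 n y Ny≈1 = s<y , -s<y
    where
    N : Carrier
    N = fromℕ (suc n)

    0<s : 0# < s
    0<s = inverse-positive (large 0) ts≈1

    0<y : 0# < y
    0<y = inverse-positive (fromℕ-nonneg (suc n)) Ny≈1

    y≰s : ¬ (y ≤ s)
    y≰s y≤s = <⇒≱ 0<s (+-cancelʳ-≤ (N * s) s+Ns≤0+Ns)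
      where
      open ≤-Reasoning
      s+Ns≤0+Ns : s + N * s ≤ 0# + N * s
      s+Ns≤0+Ns = begin
        s + N * s                ≈⟨ +-cong (*-identityʳ s) (*-comm s N) ⟨
        s * 1# + s * N           ≈⟨ distribˡ s 1# N ⟨
        s * fromℕ (suc (suc n))  ≤⟨ *-monoˡ-≤-nonneg (proj₁ 0<s) (large (suc (suc n))) ⟩
        s * t                    ≈⟨ ≈-trans (*-comm s t) (≈-trans ts≈1 (≈-sym Ny≈1)) ⟩
        N * y                    ≤⟨ *-monoˡ-≤-nonneg (fromℕ-nonneg (suc n)) y≤s ⟩
        N * s                    ≈⟨ +-identityˡ (N * s) ⟨
        0# + N * s               ∎

    s<y : s < y
    s<y = ≰⇒> y≰s

    -s<y : - s < y
    -s<y = begin-strict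
      - s   ≤⟨ -‿antimono-≤ (proj₁ 0<s) ⟩
      - 0#  ≈⟨ -0#≈0# ⟩
      0#    <⟨ 0<y ⟩
      y     ∎
      where open ≤-Reasoning

  0-infinitesimal : Infinitesimal 0#
  0-infinitesimal n y Ny≈1 = 0<y , -0<y
    where
    0<y : 0# < y
    0<y = inverse-positive (fromℕ-nonneg (suc n)) Ny≈1

    -0<y : - 0# < y
    -0<y = begin-strict
      - 0#  ≈⟨ -0#≈0# ⟩
      0#    <⟨ 0<y ⟩
      y     ∎
      where open ≤-Reasoning

  -- Infinitesimals are finite, being bounded by 1/1 = 1.
  infinitesimal⇒finite : ∀ {x} → Infinitesimal x → Finite x
  infinitesimal⇒finite {x} x-inf =
    1 , (≤-respʳ-≈ 1≈fromℕ1 (proj₁ x<1) , ≤-respʳ-≈ 1≈fromℕ1 (proj₁ -x<1))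
    where
    1≈fromℕ1 : 1# ≈ fromℕ 1
    1≈fromℕ1 = ≈-sym (+-identityʳ 1#)

    |x|<1 : abs< x 1#
    |x|<1 = x-inf 0 1# (≈-trans (*-identityʳ (fromℕ 1)) (≈-sym 1≈fromℕ1))

    x<1 : x < 1#
    x<1 = proj₁ |x|<1

    -x<1 : - x < 1#
    -x<1 = proj₂ |x|<1

  ¬abs<⇒≤⊎≤- : ExcludedMiddle ℓ → ∀ {x} n →
    ¬ abs< x (fromℕ n) → fromℕ n ≤ x ⊎ fromℕ n ≤ - x
  ¬abs<⇒≤⊎≤- em {x} n not-abs< with em {fromℕ n ≤ x} | em {fromℕ n ≤ - x}
  ... | yes n≤x | _        = inj₁ n≤x
  ... | no _    | yes n≤-x = inj₂ n≤-x
  ... | no n≰x  | no n≰-x  = ⊥-elim (not-abs< (≰⇒> n≰x , ≰⇒> n≰-x))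

  -- Classically, a point x bounded by no natural number yields an infinitely
  -- large element, namely max(x, -x).
  unbounded⇒infinitelyLarge : ExcludedMiddle ℓ → ∀ x →
    ¬ (∃[ n ] abs< x (fromℕ n)) → ∃ InfinitelyLarge
  unbounded⇒infinitelyLarge em x unbounded = larger-of (total x (- x))
    where
    n≤x⊎n≤-x : ∀ n → fromℕ n ≤ x ⊎ fromℕ n ≤ - x
    n≤x⊎n≤-x n = ¬abs<⇒≤⊎≤- em n (λ |x|<n → unbounded (n , |x|<n))

    larger-of : x ≤ - x ⊎ - x ≤ x → ∃ InfinitelyLarge
    larger-of (inj₁ x≤-x) = - x , λ n → [ (λ n≤x → ≤-trans n≤x x≤-x) , (λ n≤-x → n≤-x) ] (n≤x⊎n≤-x n)
    larger-of (inj₂ -x≤x) = x , λ n → [ (λ n≤x → n≤x) , (λ n≤-x → ≤-trans n≤-x -x≤x) ] (n≤x⊎n≤-x n)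

  no-infinitelyLarge⇒archimedean : ExcludedMiddle ℓ →
    (∀ {t} → ¬ InfinitelyLarge t) → Archimedean
  no-infinitelyLarge⇒archimedean em no-large x with em {∃[ n ] abs< x (fromℕ n)}
  ... | yes bounded = bounded
  ... | no unbounded = ⊥-elim (no-large (proj₂ (unbounded⇒infinitelyLarge em x unbounded)))

module ExtensionProperties
  {c ℓ c′ ℓ′ : Level} {K : OrderedField c ℓ} {L : OrderedField c′ ℓ′}
  (E : OrderedFieldExtension K L) where
  private
    module K = OrderedFieldProperties K
    module L = OrderedFieldProperties L
  open OrderedFieldExtension E

  ι-fromℕ : ∀ n → ι (K.fromℕ n) L.≈ L.fromℕ n
  ι-fromℕ zero = ι-0
  ι-fromℕ (suc n) = L.≈-trans (ι-+ K.1# (K.fromℕ n)) (L.+-cong ι-1 (ι-fromℕ n))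

  ι-infinitelyLarge : ∀ {t} → K.InfinitelyLarge t → L.InfinitelyLarge (ι t)
  ι-infinitelyLarge large n = L.≤-respˡ-≈ (ι-fromℕ n) (ι-mono (large n))

  ι-reciprocal : ∀ {t s} → t K.* s K.≈ K.1# → ι t L.* ι s L.≈ L.1#
  ι-reciprocal ts≈1 = L.≈-trans (L.≈-sym (ι-* _ _)) (L.≈-trans (ι-cong ts≈1) ι-1)

  UniqueDecomposition : L.Carrier → Set (c ⊔ ℓ ⊔ c′ ⊔ ℓ′)
  UniqueDecomposition α = ∀ k k′ dα dα′ → L.Infinitesimal dα → L.Infinitesimal dα′ →
    α L.≈ ι k L.+ dα → α L.≈ ι k′ L.+ dα′ → k K.≈ k′ × dα L.≈ dα′

  -- If ι k is infinitesimal and decomposes uniquely, then k ≈ 0, since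
  -- ι k = ι k + 0 = ι 0 + ι k are two such decompositions.
  standard-infinitesimal≈0 : ∀ {k} → UniqueDecomposition (ι k) →
    L.Infinitesimal (ι k) → k K.≈ K.0#
  standard-infinitesimal≈0 {k} unique ιk-inf =
    proj₁ (unique k K.0# L.0# (ι k) L.0-infinitesimal ιk-inf ιk≈ιk+0 ιk≈ι0+ιk)
    where
    ιk≈ιk+0 : ι k L.≈ ι k L.+ L.0#
    ιk≈ιk+0 = L.≈-sym (L.+-identityʳ (ι k))

    ιk≈ι0+ιk : ι k L.≈ ι K.0# L.+ ι k
    ιk≈ι0+ιk = L.≈-sym (L.≈-trans (L.+-congʳ ι-0) (L.+-identityˡ (ι k)))

  -- If finite elements decompose uniquely, K has no infinitely large t:
  -- its reciprocal s would be a standard infinitesimal, so s ≈ 0, while t s ≈ 1.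
  uniqueDecomposition⇒no-infinitelyLarge : (∀ α → L.Finite α → UniqueDecomposition α) →
    ∀ {t} → ¬ K.InfinitelyLarge t
  uniqueDecomposition⇒no-infinitelyLarge unique {t} large = K.0≉1 0≈1
    where
    t≉0 : ¬ (t K.≈ K.0#)
    t≉0 = K.infinitelyLarge≉0 large

    s : K.Carrier
    s = proj₁ (K.inverse t t≉0)

    ts≈1 : t K.* s K.≈ K.1#
    ts≈1 = proj₂ (K.inverse t t≉0)

    ιs-infinitesimal : L.Infinitesimal (ι s)
    ιs-infinitesimal = L.reciprocal-infinitesimal (ι-infinitelyLarge large) (ι-reciprocal ts≈1)

    s≈0 : s K.≈ K.0#
    s≈0 = standard-infinitesimal≈0
      (unique (ι s) (L.infinitesimal⇒finite ιs-infinitesimal)) ιs-infinitesimal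

    0≈1 : K.0# K.≈ K.1#
    0≈1 = begin
      K.0#        ≈⟨ K.zeroʳ t ⟨
      t K.* K.0#  ≈⟨ K.*-congˡ s≈0 ⟨
      t K.* s     ≈⟨ ts≈1 ⟩
      K.1#        ∎
      where open K.≈-Reasoning

lemma3p19 : ∀ {c ℓ c′ ℓ′} → ExcludedMiddle (c ⊔ ℓ ⊔ c′ ⊔ ℓ′) →
    (K : OrderedField c ℓ) (*K : OrderedField c′ ℓ′) (E : OrderedFieldExtension K *K) →
    (∀ α → OrderedField.Finite *K α →
      (∃[ k ] ∃[ dα ] (OrderedField.Infinitesimal *K dα
          × OrderedField._≈_ *K α (OrderedField._+_ *K (OrderedFieldExtension.ι E k) dα)))
      × (∀ k k′ dα dα′ → OrderedField.Infinitesimal *K dα → OrderedField.Infinitesimal *K dα′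
          → OrderedField._≈_ *K α (OrderedField._+_ *K (OrderedFieldExtension.ι E k) dα)
          → OrderedField._≈_ *K α (OrderedField._+_ *K (OrderedFieldExtension.ι E k′) dα′)
          → OrderedField._≈_ K k k′ × OrderedField._≈_ *K dα dα′)) →
    OrderedField.Archimedean K
lemma3p19 {c} {ℓ} {c′} {ℓ′} em K *K E decomposition =
  OrderedFieldProperties.no-infinitelyLarge⇒archimedean K
    (lowerExcludedMiddle (c ⊔ c′ ⊔ ℓ′) em)
    (ExtensionProperties.uniqueDecomposition⇒no-infinitelyLarge E
      (λ α α-finite → proj₂ (decomposition α α-finite)))
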